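{- Let $\mathcal{G}$ be a grounded degree sandwich monotone graph class and let $(G,\omega)$ be a weighted graph. Then $(G,\omega)$ is a level-$\mathcal{G}$ weighted graph if and only if $G\in\mathcal{G}$ and every degree-minimal edge elimination scheme of $(G,\omega)$ is a sorted $\mathcal{G}$-safe edge elimination scheme.
   Context: All graphs are finite, simple and undirected. For a graph class $\mathcal{G}$ and $G\in\mathcal{G}$, a set $F\subseteq E(G)$ is $\mathcal{G}$-safe if $G-F\in\mathcal{G}$; an edge $e$ is $\mathcal{G}$-safe if $G-e\in\mathcal{G}$. $\mathcal{G}$ is grounded if for every $G\in\mathcal{G}$ the graph $G-E(G)$ is in $\mathcal{G}$. For a graph $H$ and $F\subseteq E(H)$, an edge $uv\in F$ is degree-minimal in $F$ if (i) $u$ has the smallest degree in $H$ among all vertices incident to an edge of $F$, and (ii) $d_H(v)$ is smallest among all vertices $w$ with $uw\in F$. $\mathcal{G}$ is degree sandwich monotone if for every $G\in\mathcal{G}$ and every $\mathcal{G}$-safe set $F\subseteq E(G)$ every degree-minimal edge in $F$ is $\mathcal{G}$-safe. A weighted graph is a pair $(G,\omega)$ with $\omega:E(G)\to\{1,\dots,k\}$ surjective for some positive integer $k$; for $1\le i\le k+1$ the $i$-th level graph is obtained from $G$ by deleting all edges of weight less than $i$, and $(G,\omega)$ is level-$\mathcal{G}$ if all level graphs are in $\mathcal{G}$. For an edge ordering $\tau=(e_1,\dots,e_m)$ let $G^i_\tau=G-\{e_1,\dots,e_i\}$, $G^0_\tau=G$. $\tau$ is a sorted $\mathcal{G}$-safe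 edge elimination scheme if $G^i_\tau\in\mathcal{G}$ for all $i\in\{1,\dots,m\}$ and $\omega(e_i)\le\omega(e_j)$ whenever $i<j$. $\tau$ is a degree-minimal edge elimination scheme of $(G,\omega)$ if for every $i$, $e_i$ is a degree-minimal edge (degrees in $G^{i-1}_\tau$) in the set of minimum-weight edges of $G^{i-1}_\tau$. -}

module Defs where

open import Level using (0ℓ)
open import Data.Nat using (ℕ; zero; suc; _≤_; _<_; _<ᵇ_)
open import Data.Bool using (Bool; true; false; _∧_; _∨_; not; if_then_else_)
open import Data.Bool.Properties using (∨-comm)
open import Data.Fin using (Fin; toℕ; _≟_)
open import Data.Nat.ListAction using (sum)
open import Data.List using (List; map; allFin; take; length; lookup; _∷_; [])
open import Data.List.Relation.Unary.All using (All)
open import Data.List.Relation.Unary.Any using (Any)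
open import Data.List.Relation.Unary.AllPairs using (AllPairs)
open import Data.Product using (Σ; _×_; _,_; ∃; ∃-syntax)
open import Data.Sum using (_⊎_)
open import Relation.Nullary using (¬_; does)
open import Relation.Binary.PropositionalEquality using (_≡_; refl)

record Graph (n : ℕ) : Set where
  field
    adj  : Fin n → Fin n → Bool
    sym  : ∀ u v → adj u v ≡ adj v u
    irr  : ∀ u → adj u u ≡ false
open Graph public

Edge : ∀ {n} → Graph n → Fin n → Fin n → Set
Edge G u v = adj G u v ≡ true

deg : ∀ {n} → Graph n → Fin n → ℕ
deg {n} G u = sum (map (λ v → if adj G u v then 1 else 0) (allFin n))

-- A (Bool-valued) edge set F: the pair {x,y} belongs to F iff F x y or F y x.
EdgeSet : ℕ → Set
EdgeSet n = Fin n → Fin n → Bool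

InF : ∀ {n} → EdgeSet n → Fin n → Fin n → Set
InF F x y = (F x y ∨ F y x) ≡ true

_⊆E_ : ∀ {n} → EdgeSet n → Graph n → Set
F ⊆E G = ∀ x y → F x y ≡ true → Edge G x y

_∖_ : ∀ {n} → Graph n → EdgeSet n → Graph n
G ∖ F = record
  { adj = λ x y → adj G x y ∧ not (F x y ∨ F y x)
  ; sym = λ x y → symP x y
  ; irr = λ x → irrP x }
  where
  symP : ∀ x y → (adj G x y ∧ not (F x y ∨ F y x)) ≡ (adj G y x ∧ not (F y x ∨ F x y))
  symP x y rewrite sym G x y | ∨-comm (F x y) (F y x) = refl
  irrP : ∀ x → (adj G x x ∧ not (F x x ∨ F x x)) ≡ false
  irrP x rewrite irr G x = refl

edge : ∀ {n} → Fin n → Fin n → EdgeSet n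
edge u v x y = does (x ≟ u) ∧ does (y ≟ v)

_─_ : ∀ {n} → Graph n → Fin n × Fin n → Graph n
G ─ (u , v) = G ∖ edge u v

allEdges : ∀ {n} → EdgeSet n
allEdges _ _ = true

-- Graph classes.  A graph is determined by its vertex set and edge set,
-- so a class is a predicate respecting (pointwise) equality of edge sets.

record GraphClass : Set₁ where
  field
    _∈𝒢 : ∀ {n} → Graph n → Set
    resp : ∀ {n} {G H : Graph n} → (∀ u v → adj G u v ≡ adj H u v) → G ∈𝒢 → H ∈𝒢
open GraphClass public

Grounded : GraphClass → Set
Grounded 𝒢 = ∀ {n} (G : Graph n) → _∈𝒢 𝒢 G → _∈𝒢 𝒢 (G ∖ allEdges)

-- Degree-minimal edge uv (oriented: u is the "u" of the definition) in an
-- edge set given by a membership predicate M (the unordered pair {x,y}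
-- belongs to the set iff M x y or M y x), degrees taken in H.
DegMin : ∀ {n} → Graph n → (Fin n → Fin n → Set) → Fin n → Fin n → Set
DegMin H M u v =
  (M u v ⊎ M v u) ×
  (∀ x y → (M x y ⊎ M y x) → (deg H u ≤ deg H x × deg H u ≤ deg H y)) ×
  (∀ w → (M u w ⊎ M w u) → deg H v ≤ deg H w)

DegreeSandwichMonotone : GraphClass → Set
DegreeSandwichMonotone 𝒢 =
  ∀ {n} (G : Graph n) → _∈𝒢 𝒢 G →
  ∀ (F : EdgeSet n) → F ⊆E G → _∈𝒢 𝒢 (G ∖ F) →
  ∀ u v → DegMin G (λ x y → F x y ≡ true) u v → _∈𝒢 𝒢 (G ─ (u , v))

-- Weighted graphs (G , ω) with ω : E(G) → {1,…,k} surjective, k ≥ 1.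
-- ω is given on all pairs but only its values on edges matter.

record Weighting {n} (G : Graph n) : Set where
  field
    k     : ℕ
    k≥1   : 1 ≤ k
    ω     : Fin n → Fin n → ℕ
    ω-sym : ∀ u v → Edge G u v → ω u v ≡ ω v u
    range : ∀ u v → Edge G u v → 1 ≤ ω u v × ω u v ≤ k
    onto  : ∀ i → 1 ≤ i → i ≤ k → Σ (Fin n) λ u → Σ (Fin n) λ v → Edge G u v × ω u v ≡ i
open Weighting public

level : ∀ {n} {G : Graph n} → Weighting G → ℕ → Graph n
level {G = G} W i = G ∖ (λ x y → ω W x y <ᵇ i)

LevelClass : GraphClass → ∀ {n} {G : Graph n} → Weighting G → Set
LevelClass 𝒢 W = ∀ i → 1 ≤ i → i ≤ suc (k W) → _∈𝒢 𝒢 (level W i)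

-- Edge orderings: lists of (oriented representatives of) the edges of G,
-- every edge appearing exactly once.

SameEdge : ∀ {n} → Fin n × Fin n → Fin n × Fin n → Set
SameEdge (a , b) (c , d) = (a ≡ c × b ≡ d) ⊎ (a ≡ d × b ≡ c)

IsEdgeOrdering : ∀ {n} → Graph n → List (Fin n × Fin n) → Set
IsEdgeOrdering G τ =
  All (λ { (u , v) → Edge G u v }) τ ×
  (∀ u v → Edge G u v → Any (SameEdge (u , v)) τ) ×
  AllPairs (λ e f → ¬ SameEdge e f) τ

listSet : ∀ {n} → List (Fin n × Fin n) → EdgeSet n
listSet [] x y = false
listSet ((u , v) ∷ es) x y = edge u v x y ∨ listSet es x y

stage : ∀ {n} → Graph n → List (Fin n × Fin n) → ℕ → Graph n
stage G τ i = G ∖ listSet (take i τ)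

wt : ∀ {n} {G : Graph n} → Weighting G → Fin n × Fin n → ℕ
wt W (u , v) = ω W u v

-- sorted 𝒢-safe edge elimination scheme
-- (index j : Fin m stands for e_{j+1}; G^{j+1} removes e_1..e_{j+1})
SortedSafeScheme : GraphClass → ∀ {n} {G : Graph n} → Weighting G →
                   List (Fin n × Fin n) → Set
SortedSafeScheme 𝒢 {G = G} W τ =
  (∀ (j : Fin (length τ)) → _∈𝒢 𝒢 (stage G τ (suc (toℕ j)))) ×
  (∀ (i j : Fin (length τ)) → toℕ i < toℕ j → wt W (lookup τ i) ≤ wt W (lookup τ j))

MinWeightEdges : ∀ {n} {G : Graph n} → Weighting G → Graph n → Fin n → Fin n → Set
MinWeightEdges W H x y = Edge H x y × (∀ a b → Edge H a b → ω W x y ≤ ω W a b)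

-- degree-minimal edge elimination scheme
-- (e_{j+1} is degree-minimal in the min-weight edges of G^j, degrees in G^j)
DegMinScheme : ∀ {n} {G : Graph n} → Weighting G → List (Fin n × Fin n) → Set
DegMinScheme {G = G} W τ =
  ∀ (j : Fin (length τ)) →
    let H = stage G τ (toℕ j)
        u = Data.Product.proj₁ (lookup τ j)
        v = Data.Product.proj₂ (lookup τ j)
    in DegMin H (MinWeightEdges W H) u v ⊎ DegMin H (MinWeightEdges W H) v u

-- Along a degree-minimal scheme the current graph H keeps every edge of G that is heavier than
-- one of its own edges.  Hence deleting all minimum-weight edges of H, of weight w, leaves exactly
-- the level graph of index w + 1, which is in 𝒢; degree sandwich monotonicity then makes the
-- degree-minimal edge safe, and every deleted edge is lighter than every remaining one, so the
-- scheme is sorted.  Conversely, in a sorted scheme the stage reached after deleting the edges of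
-- weight < i is the i-th level graph, and a degree-minimal scheme always exists: minimise the
-- weight, then the degree of the first end, then the degree of the second end.
module Submission where

open import Defs
open import Data.Nat using (ℕ)
open import Data.Product using (_×_)
open import Function.Bundles using (_⇔_)

open import Data.Bool using (true; false; _∧_; _∨_; not)
import Data.Bool as Bool
open import Data.Bool.Properties using (∧-comm; ∨-comm; ∨-identityʳ; ∨-zeroʳ; T-≡)
open import Data.Fin as Fin using (Fin; toℕ; _≟_)
open import Data.Fin.Properties using (any?; all?)
open import Data.List using (List; []; _∷_; _++_; _∷ʳ_; [_]; take; drop; length; lookup; filter; allFin; cartesianProduct)
open import Data.List.Properties using (++-identityʳ; ∷ʳ-++; take++drop≡id; tabulate-lookup; filter-accept; filter-reject)
open import Data.List.Extrema.Nat using (argmin; argmin-all; f[argmin]≤f[xs])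
open import Data.List.Membership.Propositional using (_∈_)
open import Data.List.Membership.Propositional.Properties using (∈-filter⁺; ∈-allFin; ∈-cartesianProduct⁺)
open import Data.List.Relation.Unary.All as All using (All; []; _∷_)
open import Data.List.Relation.Unary.All.Properties using (all-filter; tabulate⁺)
open import Data.List.Relation.Unary.AllPairs using (AllPairs)
open import Data.List.Relation.Unary.AllPairs.Properties using (tabulate⁺-<)
open import Data.List.Relation.Unary.Any as Any using (Any; here; there)
open import Data.List.Relation.Unary.Any.Properties using (++⁺ˡ; ++⁺ʳ; ++⁻)
open import Data.Nat using (zero; suc; _≤_; _<_; _<ᵇ_; _≤?_; _<?_; z≤n; s≤s; s≤s⁻¹)
open import Data.Nat.Properties using (≤-trans; <-≤-trans; ≮⇒≥; <⇒≱; ≰⇒>; n<1+n; m≤n⇒m≤1+n; <ᵇ⇒<; <⇒<ᵇ)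
open import Data.Product using (∃-syntax; ∃₂; Σ-syntax; _,_; proj₁; proj₂; uncurry)
open import Data.Sum using (_⊎_; inj₁; inj₂)
import Data.Sum as Sum
open import Function using (_∘_; Equivalence)
open import Function.Bundles using (mk⇔)
open import Relation.Binary.PropositionalEquality as ≡ using (_≡_; refl; trans; cong; cong₂; subst)
open import Relation.Nullary using (¬_; Dec; yes; no; does; contradiction; _×-dec_; _⊎-dec_; _→-dec_)
open import Relation.Nullary.Decidable using (dec-true)
open import Relation.Unary using (Pred; Decidable; _⊆_)

∧-not-true⁺ : ∀ {a b} → a ≡ true → ¬ b ≡ true → (a ∧ not b) ≡ true
∧-not-true⁺ {b = false} refl _  = refl
∧-not-true⁺ {b = true}  _    ¬b = contradiction refl ¬b

∧-not-true⁻ : ∀ {a b} → (a ∧ not b) ≡ true → a ≡ true × ¬ b ≡ true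
∧-not-true⁻ {true}  {false} _ = refl , λ ()
∧-not-true⁻ {true}  {true}  ()
∧-not-true⁻ {false}         ()

∧-not-false : ∀ {a b} → a ≡ true → ¬ (a ∧ not b) ≡ true → b ≡ true
∧-not-false {b = true}  _    _  = refl
∧-not-false {b = false} refl ¬t = contradiction refl ¬t

≡true-ext : ∀ {a b} → (a ≡ true → b ≡ true) → (b ≡ true → a ≡ true) → a ≡ b
≡true-ext {false} {false} _   _   = refl
≡true-ext {false} {true}  _   b⇒a = b⇒a refl
≡true-ext {true}  {false} a⇒b _   = ≡.sym (a⇒b refl)
≡true-ext {true}  {true}  _   _   = refl

does-true⇒ : ∀ {a} {A : Set a} (A? : Dec A) → does A? ≡ true → A
does-true⇒ (yes a) _  = a
does-true⇒ (no _)  ()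

module _ {a p} {A : Set a} {P : Pred A p} (P? : Decidable P) (f : A → ℕ) where

  minimiser : (xs : List A) → (∀ y → y ∈ xs) → ∀ {x₀} → P x₀ →
              ∃[ x ] P x × (∀ {y} → P y → f x ≤ f y)
  minimiser xs complete {x₀} px₀ =
    argmin f x₀ candidates ,
    argmin-all f px₀ (all-filter P? xs) ,
    λ {y} py → All.lookup (f[argmin]≤f[xs] x₀ candidates) (∈-filter⁺ P? (complete y) py)
    where candidates = filter P? xs

module _ {a p q} {A : Set a} {P : Pred A p} {Q : Pred A q}
         (P? : Decidable P) (Q? : Decidable Q) (Q⊆P : Q ⊆ P) where

  length-filter-mono : ∀ xs → length (filter Q? xs) ≤ length (filter P? xs)
  length-filter-mono [] = z≤n
  length-filter-mono (x ∷ xs) with Q? x | P? x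
  ... | yes _ | yes _ = s≤s (length-filter-mono xs)
  ... | yes q | no ¬p = contradiction (Q⊆P q) ¬p
  ... | no _  | yes _ = m≤n⇒m≤1+n (length-filter-mono xs)
  ... | no _  | no _  = length-filter-mono xs

  length-filter-< : ∀ {x xs} → x ∈ xs → P x → ¬ Q x →
                    length (filter Q? xs) < length (filter P? xs)
  length-filter-< {xs = _ ∷ xs} (here refl) px ¬qx
    rewrite filter-accept P? {xs = xs} px | filter-reject Q? {xs = xs} ¬qx = s≤s (length-filter-mono xs)
  length-filter-< {xs = y ∷ xs} (there x∈xs) px ¬qx with Q? y | P? y
  ... | yes _ | yes _ = s≤s (length-filter-< x∈xs px ¬qx)
  ... | yes q | no ¬p = contradiction (Q⊆P q) ¬p
  ... | no _  | yes _ = m≤n⇒m≤1+n (length-filter-< x∈xs px ¬qx)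
  ... | no _  | no _  = length-filter-< x∈xs px ¬qx

take-induction : ∀ {a q} {A : Set a} (Q : List A → Set q) {xs : List A} → Q [] →
                 (∀ j → Q (take (toℕ j) xs) → Q (take (toℕ j) xs ∷ʳ lookup xs j)) →
                 ∀ m → Q (take m xs)
take-induction Q {[]}     q₀ _    zero    = q₀
take-induction Q {[]}     q₀ _    (suc _) = q₀
take-induction Q {_ ∷ _}  q₀ _    zero    = q₀
take-induction Q {x ∷ xs} q₀ step (suc m) =
  take-induction (Q ∘ (x ∷_)) (step Fin.zero q₀) (step ∘ Fin.suc) m

lookup∈take : ∀ {a} {A : Set a} (xs : List A) (i : Fin (length xs)) {m} →
              toℕ i < m → lookup xs i ∈ take m xs
lookup∈take (x ∷ xs) Fin.zero    {suc m} _         = here refl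
lookup∈take (x ∷ xs) (Fin.suc i) {suc m} (s≤s i<m) = there (lookup∈take xs i i<m)

module _ {a} {A : Set a} (f : A → ℕ) where

  sortedSplit : (xs : List A) →
                (∀ i j → toℕ i < toℕ j → f (lookup xs i) ≤ f (lookup xs j)) → ∀ t →
                Σ[ m ∈ Fin (suc (length xs)) ]
                  All (λ x → f x < t) (take (toℕ m) xs) × All (λ x → t ≤ f x) (drop (toℕ m) xs)
  sortedSplit [] _ t = Fin.zero , [] , []
  sortedSplit (x ∷ xs) sorted t with f x <? t
  ... | yes fx<t =
    let m , lighter , heavier = sortedSplit xs (λ i j i<j → sorted (Fin.suc i) (Fin.suc j) (s≤s i<j)) t
    in Fin.suc m , fx<t ∷ lighter , heavier
  ... | no fx≮t =
    Fin.zero , [] , t≤fx ∷ subst (All _) (tabulate-lookup xs)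
                             (tabulate⁺ λ j → ≤-trans t≤fx (sorted Fin.zero (Fin.suc j) (s≤s z≤n)))
    where t≤fx = ≮⇒≥ fx≮t

module _ {n : ℕ} where

  private
    variable
      H H′ H″ : Graph n
      x y : Fin n
      p : List (Fin n × Fin n)

  infix 4 _⊆ᵍ_ _≈ᵍ_
  infixl 6 _⊖_

  _⊆ᵍ_ : Graph n → Graph n → Set
  H ⊆ᵍ H′ = ∀ {x y} → Edge H x y → Edge H′ x y

  -- A record, unlike a bare function type, lets Agda infer both graphs from the type.
  record _≈ᵍ_ (H H′ : Graph n) : Set where
    constructor same-adj
    field adj-≡ : ∀ x y → adj H x y ≡ adj H′ x y
  open _≈ᵍ_ public

  -- stage G τ m is G ⊖ take m τ on the nose.
  _⊖_ : Graph n → List (Fin n × Fin n) → Graph n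
  H ⊖ p = H ∖ listSet p

  Edge? : (H : Graph n) → ∀ x y → Dec (Edge H x y)
  Edge? H x y = adj H x y Bool.≟ true

  Edge-sym : ∀ H → Edge H x y → Edge H y x
  Edge-sym {x} {y} H exy = trans (sym H y x) exy

  ≈⇒⊆ : H ≈ᵍ H′ → H ⊆ᵍ H′
  ≈⇒⊆ H≈H′ {x} {y} exy = trans (≡.sym (adj-≡ H≈H′ x y)) exy

  ≈-sym : H ≈ᵍ H′ → H′ ≈ᵍ H
  ≈-sym H≈H′ = same-adj λ x y → ≡.sym (adj-≡ H≈H′ x y)

  ≈-trans : H ≈ᵍ H′ → H′ ≈ᵍ H″ → H ≈ᵍ H″
  ≈-trans H≈H′ H′≈H″ = same-adj λ x y → trans (adj-≡ H≈H′ x y) (adj-≡ H′≈H″ x y)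

  ⊆-antisym : H ⊆ᵍ H′ → H′ ⊆ᵍ H → H ≈ᵍ H′
  ⊆-antisym H⊆H′ H′⊆H = same-adj λ x y → ≡true-ext H⊆H′ H′⊆H

  InF⁺ : ∀ (F : EdgeSet n) → F x y ≡ true ⊎ F y x ≡ true → InF F x y
  InF⁺         F (inj₁ fxy) rewrite fxy = refl
  InF⁺ {x} {y} F (inj₂ fyx) rewrite fyx = ∨-zeroʳ (F x y)

  InF⁻ : ∀ (F : EdgeSet n) → InF F x y → F x y ≡ true ⊎ F y x ≡ true
  InF⁻ {x} {y} F inF with F x y
  ... | true  = inj₁ refl
  ... | false = inj₂ inF

  ∖-⊆ : ∀ H F → H ∖ F ⊆ᵍ H
  ∖-⊆ _ _ exy = proj₁ (∧-not-true⁻ exy)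

  ∖-edge⁺ : ∀ H F → Edge H x y → ¬ InF F x y → Edge (H ∖ F) x y
  ∖-edge⁺ _ _ = ∧-not-true⁺

  ∖-edge⁻ : ∀ H F → Edge (H ∖ F) x y → ¬ InF F x y
  ∖-edge⁻ _ _ exy = proj₂ (∧-not-true⁻ exy)

  ∖-deleted : ∀ H F → Edge H x y → ¬ Edge (H ∖ F) x y → InF F x y
  ∖-deleted _ _ = ∧-not-false

  SameEdge-sym : ∀ {e e′ : Fin n × Fin n} → SameEdge e e′ → SameEdge e′ e
  SameEdge-sym (inj₁ (refl , refl)) = inj₁ (refl , refl)
  SameEdge-sym (inj₂ (refl , refl)) = inj₂ (refl , refl)

  ∈⇒SameEdge : (x , y) ∈ p ⊎ (y , x) ∈ p → Any (SameEdge (x , y)) p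
  ∈⇒SameEdge (inj₁ xy∈p) = Any.map (λ { refl → inj₁ (refl , refl) }) xy∈p
  ∈⇒SameEdge (inj₂ yx∈p) = Any.map (λ { refl → inj₂ (refl , refl) }) yx∈p

  SameEdge⇒∈ : Any (SameEdge (x , y)) p → (x , y) ∈ p ⊎ (y , x) ∈ p
  SameEdge⇒∈ (here (inj₁ (refl , refl))) = inj₁ (here refl)
  SameEdge⇒∈ (here (inj₂ (refl , refl))) = inj₂ (here refl)
  SameEdge⇒∈ (there s)                   = Sum.map there there (SameEdge⇒∈ s)

  listSet⁺ : (x , y) ∈ p → listSet p x y ≡ true
  listSet⁺ {x} {y} (here refl)
    rewrite dec-true (x ≟ x) refl | dec-true (y ≟ y) refl = refl
  listSet⁺ {x} {y} {(u , v) ∷ _} (there xy∈p)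
    rewrite listSet⁺ xy∈p = ∨-zeroʳ (edge u v x y)

  listSet⁻ : listSet p x y ≡ true → (x , y) ∈ p
  listSet⁻ {p = (u , v) ∷ p} {x} {y} h with x ≟ u | y ≟ v
  ... | yes refl | yes refl = here refl
  ... | yes _    | no _     = there (listSet⁻ h)
  ... | no _     | _        = there (listSet⁻ h)

  InF-listSet⁺ : ∀ p → Any (SameEdge (x , y)) p → InF (listSet p) x y
  InF-listSet⁺ p s = InF⁺ (listSet p) (Sum.map listSet⁺ listSet⁺ (SameEdge⇒∈ s))

  InF-listSet⁻ : ∀ p → InF (listSet p) x y → Any (SameEdge (x , y)) p
  InF-listSet⁻ p inF = ∈⇒SameEdge (Sum.map listSet⁻ listSet⁻ (InF⁻ (listSet p) inF))

  ⊖-⊆ : ∀ H p → H ⊖ p ⊆ᵍ H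
  ⊖-⊆ H p = ∖-⊆ H (listSet p)

  ⊖-edge⁺ : ∀ H p → Edge H x y → ¬ Any (SameEdge (x , y)) p → Edge (H ⊖ p) x y
  ⊖-edge⁺ H p exy ∉p = ∖-edge⁺ H (listSet p) exy (λ inF → ∉p (InF-listSet⁻ p inF))

  ⊖-edge⁻ : ∀ H p → Edge (H ⊖ p) x y → ¬ Any (SameEdge (x , y)) p
  ⊖-edge⁻ H p exy s = ∖-edge⁻ H (listSet p) exy (InF-listSet⁺ p s)

  ⊖-deleted : ∀ H p → Edge H x y → ¬ Edge (H ⊖ p) x y → Any (SameEdge (x , y)) p
  ⊖-deleted H p exy ¬exy = InF-listSet⁻ p (∖-deleted H (listSet p) exy ¬exy)

  ⊖-[] : ∀ H → H ⊖ [] ≈ᵍ H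
  ⊖-[] H = ⊆-antisym (⊖-⊆ H []) (λ exy → ⊖-edge⁺ H [] exy λ ())

  ⊖-++ : ∀ H p q → H ⊖ (p ++ q) ≈ᵍ H ⊖ p ⊖ q
  ⊖-++ H p q = ⊆-antisym
    (λ exy → ⊖-edge⁺ (H ⊖ p) q (⊖-edge⁺ H p (⊖-⊆ H (p ++ q) exy) (⊖-edge⁻ H (p ++ q) exy ∘ ++⁺ˡ))
                                (⊖-edge⁻ H (p ++ q) exy ∘ ++⁺ʳ p))
    (λ exy → let exy′ = ⊖-⊆ (H ⊖ p) q exy
             in ⊖-edge⁺ H (p ++ q) (⊖-⊆ H p exy′) (Sum.[ ⊖-edge⁻ H p exy′ , ⊖-edge⁻ (H ⊖ p) q exy ] ∘ ++⁻ p))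

  ─≈⊖[] : ∀ H e → H ─ e ≈ᵍ H ⊖ [ e ]
  ─≈⊖[] H (u , v) = same-adj λ x y → lemma x y
    where
    lemma : ∀ x y → adj (H ─ (u , v)) x y ≡ adj (H ⊖ [ (u , v) ]) x y
    lemma x y rewrite ∨-identityʳ (edge u v x y) | ∨-identityʳ (edge u v y x) = refl

  ─-sym : ∀ H (u v : Fin n) → H ─ (u , v) ≈ᵍ H ─ (v , u)
  ─-sym H u v = same-adj λ x y → cong (λ b → adj H x y ∧ not b)
    (trans (cong₂ _∨_ (∧-comm (does (x ≟ u)) (does (y ≟ v))) (∧-comm (does (y ≟ u)) (does (x ≟ v))))
           (∨-comm (edge v u y x) (edge v u x y)))

  ⊖-∷ʳ : ∀ H p e → H ⊖ (p ∷ʳ e) ≈ᵍ (H ⊖ p) ─ e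
  ⊖-∷ʳ H p e = ≈-trans (⊖-++ H p [ e ]) (≈-sym (─≈⊖[] (H ⊖ p) e))

  stageEdges⇒IsEdgeOrdering : ∀ H {τ} →
    (∀ j → Edge (H ⊖ take (toℕ j) τ) (proj₁ (lookup τ j)) (proj₂ (lookup τ j))) →
    (∀ {x y} → Edge H x y → Any (SameEdge (x , y)) τ) → IsEdgeOrdering H τ
  stageEdges⇒IsEdgeOrdering H {τ} stageEdge covers =
    subst (All _) (tabulate-lookup τ) (tabulate⁺ λ j → ⊖-⊆ H (take (toℕ j) τ) (stageEdge j)) ,
    (λ _ _ → covers) ,
    subst (AllPairs _) (tabulate-lookup τ) (tabulate⁺-< λ {i} {j} i<j same →
      ⊖-edge⁻ H (take (toℕ j) τ) (stageEdge j) (Any.map (λ { refl → SameEdge-sym same }) (lookup∈take τ i i<j)))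

∈𝒢-resp : ∀ (𝒢 : GraphClass) {n} {H H′ : Graph n} → H ≈ᵍ H′ → _∈𝒢 𝒢 H → _∈𝒢 𝒢 H′
∈𝒢-resp 𝒢 H≈H′ = resp 𝒢 (adj-≡ H≈H′)

DegMin-cong : ∀ {n} {H : Graph n} {M M′ : Fin n → Fin n → Set} {u v} →
              (∀ {x y} → M x y → M′ x y) → (∀ {x y} → M′ x y → M x y) →
              DegMin H M u v → DegMin H M′ u v
DegMin-cong M⇒M′ M′⇒M (m , minᵤ , minᵥ) =
  Sum.map M⇒M′ M⇒M′ m ,
  (λ x y m′ → minᵤ x y (Sum.map M′⇒M M′⇒M m′)) ,
  (λ w m′ → minᵥ w (Sum.map M′⇒M M′⇒M m′))

module _ {n : ℕ} where

  pairs : List (Fin n × Fin n)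
  pairs = cartesianProduct (allFin n) (allFin n)

  ∈-pairs : ∀ e → e ∈ pairs
  ∈-pairs (x , y) = ∈-cartesianProduct⁺ (∈-allFin x) (∈-allFin y)

  degMinEdge : ∀ (H : Graph n) {M : Fin n → Fin n → Set} → (∀ x y → Dec (M x y)) →
               ∀ {a b} → M a b → ∃₂ (DegMin H M)
  degMinEdge H {M} M? {a} {b} mab =
    let u , (_ , mᵤ) , minᵤ = minimiser (λ x → any? λ y → M? x y ⊎-dec M? y x) (deg H)
                                        (allFin n) ∈-allFin (b , inj₁ mab)
        v , mᵤᵥ , minᵥ     = minimiser (λ y → M? u y ⊎-dec M? y u) (deg H) (allFin n) ∈-allFin mᵤ
    in u , v , mᵤᵥ , (λ x y m → minᵤ (y , m) , minᵤ (x , Sum.swap m)) , (λ _ m → minᵥ m)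

  edgeCount : Graph n → ℕ
  edgeCount H = length (filter (uncurry (Edge? H)) pairs)

  edgeCount-< : ∀ {H H′ : Graph n} {x y} → H′ ⊆ᵍ H → Edge H x y → ¬ Edge H′ x y →
                edgeCount H′ < edgeCount H
  edgeCount-< {H} {H′} H′⊆H exy ¬exy =
    length-filter-< (uncurry (Edge? H)) (uncurry (Edge? H′)) H′⊆H (∈-pairs _) exy ¬exy

  edgeCount-⊖-∷ʳ : ∀ H p {x y} → Edge (H ⊖ p) x y → edgeCount (H ⊖ (p ∷ʳ (x , y))) < edgeCount (H ⊖ p)
  edgeCount-⊖-∷ʳ H p {x} {y} exy = edgeCount-< {H = H ⊖ p} {H′ = H ⊖ (p ∷ʳ (x , y))}
    (⊖-⊆ (H ⊖ p) [ (x , y) ] ∘ ≈⇒⊆ (⊖-++ H p [ (x , y) ])) exy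
    (λ exy′ → ⊖-edge⁻ H (p ∷ʳ (x , y)) exy′ (++⁺ʳ p (here (inj₁ (refl , refl)))))

module _ {n : ℕ} {G : Graph n} (W : Weighting G) where

  private
    variable
      H : Graph n
      x y u v : Fin n
      e : Fin n × Fin n
      t : ℕ

    ω-≡ : Edge G x y → ω W x y ≡ ω W y x
    ω-≡ {x} {y} = ω-sym W x y

  SameEdge-wt : Edge G x y → SameEdge (x , y) e → wt W e ≡ ω W x y
  SameEdge-wt _   (inj₁ (refl , refl)) = refl
  SameEdge-wt exy (inj₂ (refl , refl)) = ≡.sym (ω-≡ exy)

  lighter : ℕ → EdgeSet n
  lighter t a b = ω W a b <ᵇ t

  level-edge⁺ : Edge G x y → t ≤ ω W x y → Edge (level W t) x y
  level-edge⁺ {x} {y} {t} exy t≤ω = ∖-edge⁺ G (lighter t) exy λ inF →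
    Sum.[ (λ lt → <⇒≱ (<ᵇ-true lt) t≤ω) , (λ lt → <⇒≱ (<ᵇ-true lt) (subst (t ≤_) (ω-≡ exy) t≤ω)) ]
      (InF⁻ (lighter t) inF)
    where <ᵇ-true : ∀ {m} → (m <ᵇ t) ≡ true → m < t
          <ᵇ-true {m} h = <ᵇ⇒< m t (Equivalence.from T-≡ h)

  level-edge⁻ : Edge (level W t) x y → t ≤ ω W x y
  level-edge⁻ {t} {x} {y} exy = ≮⇒≥ λ ω<t →
    ∖-edge⁻ G (lighter t) exy (InF⁺ (lighter t) (inj₁ (Equivalence.to T-≡ (<⇒<ᵇ ω<t))))

  level-1≈ : level W 1 ≈ᵍ G
  level-1≈ = ⊆-antisym (∖-⊆ G (lighter 1)) (λ exy → level-edge⁺ exy (proj₁ (range W _ _ exy)))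

  MinWeightEdges? : ∀ (H : Graph n) x y → Dec (MinWeightEdges W H x y)
  MinWeightEdges? H x y =
    Edge? H x y ×-dec all? λ a → all? λ b → Edge? H a b →-dec ω W x y ≤? ω W a b

  MinWeightEdges-sym : H ⊆ᵍ G → MinWeightEdges W H x y → MinWeightEdges W H y x
  MinWeightEdges-sym {H} {x} {y} H⊆G (exy , min) =
    Edge-sym H exy , λ a b eab → subst (_≤ ω W a b) (ω-≡ (H⊆G exy)) (min a b eab)

  -- DegMinScheme W τ unfolds to ∀ j → DegMinStep (G ⊖ take (toℕ j) τ) (lookup τ j).
  DegMinStep : Graph n → Fin n × Fin n → Set
  DegMinStep H (u , v) = DegMin H (MinWeightEdges W H) u v ⊎ DegMin H (MinWeightEdges W H) v u

  DegMinStep⇒MinWeight : H ⊆ᵍ G → DegMinStep H (u , v) → MinWeightEdges W H u v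
  DegMinStep⇒MinWeight     H⊆G (inj₁ (inj₁ m , _)) = m
  DegMinStep⇒MinWeight {H} H⊆G (inj₁ (inj₂ m , _)) = MinWeightEdges-sym {H} H⊆G m
  DegMinStep⇒MinWeight {H} H⊆G (inj₂ (inj₁ m , _)) = MinWeightEdges-sym {H} H⊆G m
  DegMinStep⇒MinWeight     H⊆G (inj₂ (inj₂ m , _)) = m

  scheme-minWeight : ∀ {τ} → DegMinScheme W τ → ∀ j →
                     MinWeightEdges W (G ⊖ take (toℕ j) τ) (proj₁ (lookup τ j)) (proj₂ (lookup τ j))
  scheme-minWeight {τ} dms j = DegMinStep⇒MinWeight {G ⊖ take (toℕ j) τ} (⊖-⊆ G (take (toℕ j) τ)) (dms j)

  UpwardClosed : Graph n → Set
  UpwardClosed H = ∀ {a b x y} → Edge H a b → Edge G x y → ω W a b < ω W x y → Edge H x y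

  UpwardClosed-resp : ∀ {H H′} → H ≈ᵍ H′ → UpwardClosed H → UpwardClosed H′
  UpwardClosed-resp H≈H′ up eab exy lt = ≈⇒⊆ H≈H′ (up (≈⇒⊆ (≈-sym H≈H′) eab) exy lt)

  UpwardClosed-─ : ∀ {H} → UpwardClosed H → MinWeightEdges W H u v → UpwardClosed (H ─ (u , v))
  UpwardClosed-─ {u} {v} {H} up (_ , min) {a} {b} {x} {y} eab exy ωab<ωxy =
    ≈⇒⊆ (≈-sym (─≈⊖[] H (u , v)))
      (⊖-edge⁺ H [ (u , v) ] (up eab′ exy ωab<ωxy) λ { (here same) →
        <⇒≱ ωab<ωxy (subst (_≤ ω W a b) (SameEdge-wt exy same) (min a b eab′)) })
    where eab′ = ∖-⊆ H (edge u v) eab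

  minWeightSet : Graph n → EdgeSet n
  minWeightSet H x y = does (MinWeightEdges? H x y)

  minWeightSet⇒ : minWeightSet H x y ≡ true → MinWeightEdges W H x y
  minWeightSet⇒ {H} {x} {y} = does-true⇒ (MinWeightEdges? H x y)

  minWeightDeletion≈level : H ⊆ᵍ G → UpwardClosed H → MinWeightEdges W H u v →
                            H ∖ minWeightSet H ≈ᵍ level W (suc (ω W u v))
  minWeightDeletion≈level {H} {u} {v} H⊆G up (euv , min) = ⊆-antisym ⊆level level⊆
    where
    ⊆level : H ∖ minWeightSet H ⊆ᵍ level W (suc (ω W u v))
    ⊆level {x} {y} exy = level-edge⁺ (H⊆G exyᴴ) (≰⇒> λ ω≤w →
      ∖-edge⁻ H (minWeightSet H) exy (InF⁺ (minWeightSet H) (inj₁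
        (dec-true (MinWeightEdges? H x y) (exyᴴ , λ a b eab → ≤-trans ω≤w (min a b eab))))))
      where exyᴴ = ∖-⊆ H (minWeightSet H) exy
    level⊆ : level W (suc (ω W u v)) ⊆ᵍ H ∖ minWeightSet H
    level⊆ {x} {y} exy = ∖-edge⁺ H (minWeightSet H) exyᴴ λ inF →
      Sum.[ (λ m → <⇒≱ w<ω (proj₂ (minWeightSet⇒ {H} m) u v euv))
          , (λ m → <⇒≱ (subst (ω W u v <_) (ω-≡ exyᴳ) w<ω) (proj₂ (minWeightSet⇒ {H} m) u v euv)) ]
        (InF⁻ (minWeightSet H) inF)
      where exyᴳ = ∖-⊆ G (lighter (suc (ω W u v))) exy
            w<ω = level-edge⁻ exy
            exyᴴ = up euv exyᴳ w<ω

  ⊖≈level : ∀ {p s} → (∀ {x y} → Edge G x y → Any (SameEdge (x , y)) (p ++ s)) →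
            All (λ e → wt W e < t) p → All (λ e → t ≤ wt W e) s → G ⊖ p ≈ᵍ level W t
  ⊖≈level {t} {p} {s} covers lighterPrefix heavierSuffix = ⊆-antisym ⊆level level⊆
    where
    ⊆level : G ⊖ p ⊆ᵍ level W t
    ⊆level exy = level-edge⁺ {t = t} exyᴳ
      (Sum.[ (λ ∈p → contradiction ∈p (⊖-edge⁻ G p exy))
           , (λ ∈s → let t≤ , same = All.lookupAny heavierSuffix ∈s
                     in subst (t ≤_) (SameEdge-wt exyᴳ same) t≤) ]
        (++⁻ p (covers exyᴳ)))
      where exyᴳ = ⊖-⊆ G p exy
    level⊆ : level W t ⊆ᵍ G ⊖ p
    level⊆ exy = ⊖-edge⁺ G p exyᴳ λ ∈p →
      let ω<t , same = All.lookupAny lighterPrefix ∈p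
      in <⇒≱ (subst (_< t) (SameEdge-wt exyᴳ same) ω<t) (level-edge⁻ exy)
      where exyᴳ = ∖-⊆ G (lighter t) exy

  minWeightEdge : ∀ (H : Graph n) {a b} → Edge H a b → ∃₂ (MinWeightEdges W H)
  minWeightEdge H eab =
    let (x , y) , exy , min = minimiser (uncurry (Edge? H)) (uncurry (ω W)) pairs ∈-pairs eab
    in x , y , exy , λ a b eab → min {a , b} eab

  degMinStep : ∀ (H : Graph n) {a b} → Edge H a b → ∃[ e ] DegMinStep H e
  degMinStep H eab =
    let x , y , mxy = minWeightEdge H eab
        u , v , dm  = degMinEdge H (MinWeightEdges? H) mxy
    in (u , v) , inj₁ dm

  DegMinContinuation : List (Fin n × Fin n) → Set
  DegMinContinuation p = Σ[ s ∈ List (Fin n × Fin n) ]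
    (∀ j → DegMinStep (G ⊖ (p ++ take (toℕ j) s)) (lookup s j)) ×
    (∀ {x y} → Edge (G ⊖ p) x y → Any (SameEdge (x , y)) s)

  degMinContinuation-∷ : ∀ {p e} → DegMinStep (G ⊖ p) e → DegMinContinuation (p ∷ʳ e) → DegMinContinuation p
  degMinContinuation-∷ {p} {e} dm (s , dms , covers) = e ∷ s , dms′ , covers′
    where
    dms′ : ∀ j → DegMinStep (G ⊖ (p ++ take (toℕ j) (e ∷ s))) (lookup (e ∷ s) j)
    dms′ Fin.zero    = subst (λ q → DegMinStep (G ⊖ q) e) (≡.sym (++-identityʳ p)) dm
    dms′ (Fin.suc j) = subst (λ q → DegMinStep (G ⊖ q) (lookup s j)) (∷ʳ-++ p e (take (toℕ j) s)) (dms j)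
    covers′ : ∀ {x y} → Edge (G ⊖ p) x y → Any (SameEdge (x , y)) (e ∷ s)
    covers′ {x} {y} exy with Edge? (G ⊖ (p ∷ʳ e)) x y
    ... | yes exy′ = there (covers exy′)
    ... | no ¬exy′ = here (Sum.[ (λ ∈p → contradiction ∈p (⊖-edge⁻ G p exy)) , (λ { (here same) → same }) ]
                             (++⁻ p (⊖-deleted G (p ∷ʳ e) (⊖-⊆ G p exy) ¬exy′)))

  degMinContinuation : ∀ m p → edgeCount (G ⊖ p) < m → DegMinContinuation p
  degMinContinuation (suc m) p bound with any? (λ x → any? (λ y → Edge? (G ⊖ p) x y))
  ... | no edgeless = [] , (λ ()) , λ exy → contradiction (_ , _ , exy) edgeless
  ... | yes (_ , _ , eab) =
    let e , dm = degMinStep (G ⊖ p) eab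
        shrinks = edgeCount-⊖-∷ʳ G p (proj₁ (DegMinStep⇒MinWeight {G ⊖ p} (⊖-⊆ G p) dm))
    in degMinContinuation-∷ {p} dm (degMinContinuation m (p ∷ʳ e) (<-≤-trans shrinks (s≤s⁻¹ bound)))

  degMinEdgeOrdering : ∃[ τ ] IsEdgeOrdering G τ × DegMinScheme W τ
  degMinEdgeOrdering =
    let τ , dms , covers = degMinContinuation _ [] (n<1+n _)
    in τ , stageEdges⇒IsEdgeOrdering G (proj₁ ∘ scheme-minWeight dms) (covers ∘ ≈⇒⊆ (≈-sym (⊖-[] G))) , dms

  module _ (𝒢 : GraphClass) where

    private
      _∈𝒢′ : Graph n → Set
      _∈𝒢′ = _∈𝒢 𝒢

    degMinDeletion-∈𝒢 : DegreeSandwichMonotone 𝒢 → LevelClass 𝒢 W →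
                        H ⊆ᵍ G → UpwardClosed H → H ∈𝒢′ → DegMinStep H (u , v) → (H ─ (u , v)) ∈𝒢′
    degMinDeletion-∈𝒢 {H} {u} {v} dsm lev H⊆G up H∈ dm with DegMinStep⇒MinWeight {H} H⊆G dm
    ... | minUV@(euv , _) = orient dm
      where
      F = minWeightSet H
      H∖F∈ : (H ∖ F) ∈𝒢′
      H∖F∈ = ∈𝒢-resp 𝒢 (≈-sym (minWeightDeletion≈level {H} H⊆G up minUV))
               (lev (suc (ω W u v)) (s≤s z≤n) (s≤s (proj₂ (range W u v (H⊆G euv)))))
      delete : ∀ a b → DegMin H (MinWeightEdges W H) a b → (H ─ (a , b)) ∈𝒢′
      delete a b = dsm H H∈ F (λ x y → proj₁ ∘ minWeightSet⇒ {H}) H∖F∈ a b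
                 ∘ DegMin-cong {H = H} (λ {x} {y} → dec-true (MinWeightEdges? H x y)) (minWeightSet⇒ {H})
      orient : DegMinStep H (u , v) → (H ─ (u , v)) ∈𝒢′
      orient (inj₁ dm) = delete u v dm
      orient (inj₂ dm) = ∈𝒢-resp 𝒢 (─-sym H v u) (delete v u dm)

    degMinScheme⇒sortedSafe : DegreeSandwichMonotone 𝒢 → LevelClass 𝒢 W → G ∈𝒢′ →
                              ∀ {τ} → DegMinScheme W τ → SortedSafeScheme 𝒢 W τ
    degMinScheme⇒sortedSafe dsm lev G∈ {τ} dms = (λ j → proj₁ (invariant (suc (toℕ j)))) , sorted
      where
      Invariant : List (Fin n × Fin n) → Set
      Invariant p = (G ⊖ p) ∈𝒢′ × UpwardClosed (G ⊖ p)

      step : ∀ j → Invariant (take (toℕ j) τ) → Invariant (take (toℕ j) τ ∷ʳ lookup τ j)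
      step j (H∈ , up) =
        ∈𝒢-resp 𝒢 H─e≈ (degMinDeletion-∈𝒢 {G ⊖ p} dsm lev (⊖-⊆ G p) up H∈ (dms j)) ,
        UpwardClosed-resp H─e≈ (UpwardClosed-─ {H = G ⊖ p} up (scheme-minWeight dms j))
        where p = take (toℕ j) τ
              H─e≈ = ≈-sym (⊖-∷ʳ G p (lookup τ j))

      invariant : ∀ m → Invariant (take m τ)
      invariant = take-induction Invariant
        (∈𝒢-resp 𝒢 (≈-sym (⊖-[] G)) G∈ , λ _ exy _ → ≈⇒⊆ (≈-sym (⊖-[] G)) exy) step

      sorted : ∀ i j → toℕ i < toℕ j → wt W (lookup τ i) ≤ wt W (lookup τ j)
      sorted i j i<j = ≮⇒≥ λ ωj<ωi →
        ⊖-edge⁻ G (take (toℕ j) τ) (proj₂ (invariant (toℕ j)) (proj₁ (scheme-minWeight dms j)) eᵢ ωj<ωi)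
          (∈⇒SameEdge (inj₁ (lookup∈take τ i i<j)))
        where eᵢ = ⊖-⊆ G (take (toℕ i) τ) (proj₁ (scheme-minWeight dms i))

    sortedSafe⇒levelClass : G ∈𝒢′ → ∀ {τ} → IsEdgeOrdering G τ → SortedSafeScheme 𝒢 W τ →
                            LevelClass 𝒢 W
    sortedSafe⇒levelClass G∈ {τ} (_ , covers , _) (safe , sorted) t _ _ =
      let m , lighterPrefix , heavierSuffix = sortedSplit (wt W) τ sorted t
          covers′ = λ {x} {y} exy →
            subst (Any (SameEdge (x , y))) (≡.sym (take++drop≡id (toℕ m) τ)) (covers x y exy)
      in ∈𝒢-resp 𝒢 (⊖≈level covers′ lighterPrefix heavierSuffix) (stage∈𝒢 m)
      where
      stage∈𝒢 : ∀ (m : Fin (suc (length τ))) → (G ⊖ take (toℕ m) τ) ∈𝒢′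
      stage∈𝒢 Fin.zero    = ∈𝒢-resp 𝒢 (≈-sym (⊖-[] G)) G∈
      stage∈𝒢 (Fin.suc j) = safe j

lemma3p1 : (𝒢 : GraphClass) → Grounded 𝒢 → DegreeSandwichMonotone 𝒢 →
           ∀ {n : ℕ} (G : Graph n) (W : Weighting G) →
           LevelClass 𝒢 W ⇔
             (_∈𝒢 𝒢 G × (∀ τ → IsEdgeOrdering G τ → DegMinScheme W τ → SortedSafeScheme 𝒢 W τ))
lemma3p1 𝒢 _ dsm G W = mk⇔
  (λ lev → let G∈ = G∈𝒢 lev in G∈ , λ _ _ → degMinScheme⇒sortedSafe W 𝒢 dsm lev G∈)
  (λ (G∈ , schemesSafe) → let τ , ordering , dms = degMinEdgeOrdering W
                          in sortedSafe⇒levelClass W 𝒢 G∈ ordering (schemesSafe τ ordering dms))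
  where
  G∈𝒢 : LevelClass 𝒢 W → _∈𝒢 𝒢 G
  G∈𝒢 lev = ∈𝒢-resp 𝒢 (level-1≈ W) (lev 1 (s≤s z≤n) (s≤s z≤n))
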